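{- Let $S_l\subseteq G$ be upwards-closed and modular, let $P$ be a BG-path for $S_l$ and let $S_{l+1}:=S_l\cup P$. Then $P$ is a chain if and only if $S_{l+1}$ is upwards-closed and modular.
   Context: $G$ is a simple $3$-connected graph. DFS-tree $T$ with root $r$, depth-first indices (DFI); $v$ is an ancestor of $w$ if $v$ lies on the tree path from $r$ to $w$; a backedge is a non-tree edge $vw$ oriented from the ancestor $v$ to $w$. Chain decomposition: choose backedges $ra,rb$, $x:=$ lowest common ancestor of $a,b$; $C_0:=$ tree path $x\to r$, $C_1:=ra$ plus tree path $a\to x$, $C_2:=rb$ plus tree path $b\to x$; then for each vertex $v$ in increasing DFI order and each backedge $vw$ not yet in a chain, $vw$ plus the tree path from $w$ towards $r$ up to the first vertex already in a chain is the next chain. The set of chains is fixed by this decomposition. $S_l$ is a subgraph of $G$ that is a subdivision of a graph (occurring in a sequence of subdivisions built from $C_0\cup C_1\cup C_2$ by adding BG-paths). For such $S$: real vertices are those of degree $\ge3$ in $S$; links are paths of $S$ with real end vertices and no inner real vertex; links are parallel if they share end vertices; a BG-path for $S$ is a path $P$ in $G$ from $x$ to $y$ with (i) $P\cap S=\{x,y\}$, (ii) every link of $S$ containing $x$ and $y$ has them as end vertices, (iii) if $x,y$ are inner vertices of links $L_x,L_y$ and $S$ has $\ge 4$ real vertices then $L_x,L_y$ are not parallel. $S$ is upwards-closed if for every vertex of $S$ other than $r$ the tree edge to its parent in $T$ is in $S$, and modular if $S$ is a union of chains. -}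

module Defs where

open import Level using (Level)
open import Data.Nat using (ℕ; _≤_)
open import Data.Fin using (Fin)
open import Data.List using (List; []; _∷_; _++_; length; reverse)
open import Data.List.Membership.Propositional using (_∈_; _∉_)
open import Data.List.Relation.Unary.All using (All)
open import Data.List.Relation.Unary.Any using (Any)
open import Data.List.Relation.Unary.Linked using (Linked)
open import Data.List.Relation.Unary.Unique.Propositional using (Unique)
open import Data.List.Relation.Binary.Subset.Propositional using (_⊆_)
open import Data.Product using (Σ; ∃; ∃₂; _×_; _,_; proj₁)
open import Data.Sum using (_⊎_)
open import Relation.Binary.PropositionalEquality using (_≡_; _≢_)
open import Relation.Nullary using (¬_)
open import Function.Bundles using (_⇔_)

record Graph (n : ℕ) : Set₁ where
  field
    Adj    : Fin n → Fin n → Set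
    sym    : ∀ {u v} → Adj u v → Adj v u
    irrefl : ∀ {u} → ¬ Adj u u
open Graph public

module _ {A : Set} where

  data Consec (u v : A) : List A → Set where
    here  : ∀ {xs} → Consec u v (u ∷ v ∷ xs)
    there : ∀ {x xs} → Consec u v xs → Consec u v (x ∷ xs)

  EdgeOf : A → A → List A → Set
  EdgeOf u v ps = Consec u v ps ⊎ Consec v u ps

  Ends : List A → A → A → Set
  Ends ps x y = ∃ λ mid → ps ≡ x ∷ (mid ++ y ∷ [])

  Inner : A → List A → Set
  Inner v ps = ∃₂ λ x y → ∃ λ mid → ps ≡ x ∷ (mid ++ y ∷ []) × v ∈ mid

  IsPathIn : (A → A → Set) → List A → Set
  IsPathIn E ps = Linked E ps × Unique ps × 2 ≤ length ps

module _ {n : ℕ} (G : Graph n) where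

  ConnectedWithout : List (Fin n) → Set
  ConnectedWithout X = ∀ u v → u ∉ X → v ∉ X → u ≢ v →
    ∃ λ ps → IsPathIn (Adj G) ps × Ends ps u v × All (λ w → w ∉ X) ps

  ThreeConnected : Set
  ThreeConnected = 4 ≤ n × (∀ X → length X ≤ 2 → ConnectedWithout X)

iter : {A : Set} → (A → A) → ℕ → A → A
iter f ℕ.zero    a = a
iter f (ℕ.suc k) a = f (iter f k a)

Anc : {n : ℕ} → (Fin n → Fin n) → Fin n → Fin n → Set
Anc p v w = ∃ λ k → iter p k w ≡ v

-- A rooted spanning tree is a DFS tree iff it is normal (every edge of G
-- joins an ancestor and a descendant), and the DFI are then a preorder
-- numbering of T (ancestors first, every subtree numbered contiguously).
record DFSTree {n : ℕ} (G : Graph n) : Set where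
  field
    root         : Fin n
    parent       : Fin n → Fin n
    parent-root  : parent root ≡ root
    tree-edge    : ∀ v → v ≢ root → Adj G v (parent v)
    spanning     : ∀ v → Anc parent root v
    palm         : ∀ u v → Adj G u v → Anc parent u v ⊎ Anc parent v u
    dfi          : Fin n → ℕ
    dfi-inj      : ∀ u v → dfi u ≡ dfi v → u ≡ v
    dfi-anc      : ∀ v w → Anc parent v w → dfi v ≤ dfi w
    dfi-interval : ∀ v u w → Anc parent v w → dfi v ≤ dfi u → dfi u ≤ dfi w →
                   Anc parent v u
open DFSTree public

module _ {n : ℕ} {G : Graph n} (T : DFSTree G) where

  Ancestor : Fin n → Fin n → Set
  Ancestor = Anc (parent T)

  Backedge : Fin n → Fin n → Set
  Backedge v w = Adj G v w × Ancestor v w × parent T w ≢ v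

  LCA : Fin n → Fin n → Fin n → Set
  LCA x a b = Ancestor x a × Ancestor x b ×
              (∀ z → Ancestor z a → Ancestor z b → Ancestor z x)

  data TreePath : Fin n → Fin n → List (Fin n) → Set where
    stop : ∀ {u} → TreePath u u (u ∷ [])
    step : ∀ {w u ps} → w ≢ u → TreePath (parent T w) u ps → TreePath w u (w ∷ ps)

  data UpTo (Cov : Fin n → Set) : Fin n → List (Fin n) → Set where
    stop : ∀ {u} → Cov u → UpTo Cov u (u ∷ [])
    step : ∀ {w ps} → ¬ Cov w → UpTo Cov (parent T w) ps → UpTo Cov w (w ∷ ps)

  -- the chains generated by processing the backedges in the given order,
  -- Cov being the set of vertices already contained in a chain
  data Build : (Fin n → Set) → List (Fin n × Fin n) → List (List (Fin n)) → Set₁ where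
    []  : ∀ {Cov} → Build Cov [] []
    _∷_ : ∀ {Cov v w es ps rest} → UpTo Cov w ps →
          Build (λ u → Cov u ⊎ u ∈ (v ∷ ps)) es rest →
          Build Cov ((v , w) ∷ es) ((v ∷ ps) ∷ rest)

  record IsChainDecomposition (Cs : List (List (Fin n))) : Set₁ where
    field
      a b x    : Fin n
      ra       : Backedge (root T) a
      rb       : Backedge (root T) b
      a≢b      : a ≢ b
      lca      : LCA x a b
      C0 c1 c2 : List (Fin n)
      rest     : List (List (Fin n))
      Cs-eq    : Cs ≡ C0 ∷ (root T ∷ c1) ∷ (root T ∷ c2) ∷ rest
      C0-path  : TreePath x (root T) C0
      c1-path  : TreePath a x c1
      c2-path  : TreePath b x c2
      es       : List (Fin n × Fin n)
      es-back  : All (λ e → Backedge (proj₁ e) (Data.Product.proj₂ e)) es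
      es-uniq  : Unique es
      es-all   : ∀ v w → Backedge v w → (v , w) ≢ (root T , a) →
                 (v , w) ≢ (root T , b) → (v , w) ∈ es
      es-ra    : (root T , a) ∉ es
      es-rb    : (root T , b) ∉ es
      es-order : Linked (λ e e' → dfi T (proj₁ e) ≤ dfi T (proj₁ e')) es
      build    : Build (λ u → u ∈ C0 ⊎ u ∈ (root T ∷ c1) ⊎ u ∈ (root T ∷ c2)) es rest

-- Subgraphs (given by their edges; vertices = endpoints of edges)

Sub : ℕ → Set₁
Sub n = Fin n → Fin n → Set

module _ {n : ℕ} where

  SEdge : Sub n → Fin n → Fin n → Set
  SEdge S u v = S u v ⊎ S v u

  VertexOf : Sub n → Fin n → Set
  VertexOf S v = ∃ λ u → SEdge S v u

  _∪P_ : Sub n → List (Fin n) → Sub n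
  (S ∪P P) u v = S u v ⊎ Consec u v P

  chainsSub : List (List (Fin n)) → Sub n
  chainsSub Cs u v = Any (Consec u v) Cs

  Real : Sub n → Fin n → Set
  Real S v = ∃₂ λ u₁ u₂ → ∃ λ u₃ → Unique (u₁ ∷ u₂ ∷ u₃ ∷ []) ×
             SEdge S v u₁ × SEdge S v u₂ × SEdge S v u₃

  AtLeast4Real : Sub n → Set
  AtLeast4Real S = ∃₂ λ a b → ∃₂ λ c d →
    Unique (a ∷ b ∷ c ∷ d ∷ []) × All (Real S) (a ∷ b ∷ c ∷ d ∷ [])

  IsLink : Sub n → List (Fin n) → Set
  IsLink S L = IsPathIn (SEdge S) L ×
               (∀ x y → Ends L x y → Real S x × Real S y) ×
               (∀ v → Inner v L → ¬ Real S v)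

  Parallel : List (Fin n) → List (Fin n) → Set
  Parallel L L' = ∃₂ λ a b → Ends L a b × (Ends L' a b ⊎ Ends L' b a)

  IsBGPath : Graph n → Sub n → List (Fin n) → Set
  IsBGPath G S P = ∃₂ λ x y → Ends P x y ×
    IsPathIn (Adj G) P ×
    (VertexOf S x × VertexOf S y × (∀ v → Inner v P → ¬ VertexOf S v) ×
       (∀ u v → Consec u v P → ¬ SEdge S u v)) ×
    (∀ L → IsLink S L → x ∈ L → y ∈ L → Ends L x y ⊎ Ends L y x) ×
    (∀ Lx Ly → IsLink S Lx → IsLink S Ly → Inner x Lx → Inner y Ly →
       AtLeast4Real S → ¬ Parallel Lx Ly)

module _ {n : ℕ} {G : Graph n} (T : DFSTree G) where

  data InSequence (Cs : List (List (Fin n))) : Sub n → Set₁ where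
    base : ∀ {C0 C1 C2 rest} → Cs ≡ C0 ∷ C1 ∷ C2 ∷ rest →
           InSequence Cs (chainsSub (C0 ∷ C1 ∷ C2 ∷ []))
    add  : ∀ {S P} → InSequence Cs S → IsBGPath G S P → InSequence Cs (S ∪P P)

  UpwardsClosed : Sub n → Set
  UpwardsClosed S = ∀ v → VertexOf S v → v ≢ root T → SEdge S v (parent T v)

  Modular : List (List (Fin n)) → Sub n → Set
  Modular Cs S = ∃ λ Ds → Ds ⊆ Cs × (∀ u v → SEdge S u v ⇔ Any (EdgeOf u v) Ds)

  -- the path P is one of the chains (as a subgraph, i.e. up to reversal)
  IsChain : List (List (Fin n)) → List (Fin n) → Set
  IsChain Cs P = Any (λ C → P ≡ C ⊎ P ≡ reverse C) Cs

module Submission where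

-- Two facts about the chain decomposition carry the proof:
--  (a) C₀ climbs the DFS tree, every other chain is a backedge followed by a
--      walk climbing the tree; in particular no chain backtracks;
--  (b) chains are edge-disjoint: a backedge belongs to the chain it starts,
--      a tree edge y (p y) to the chain that first covered y (C₀, C₁, C₂ being
--      separated by the lowest common ancestor x of a and b).
-- (⇒) If P is a chain C, S ∪ P is the union of C and the chains of S, and by
--     (a) the inner vertices of P are joined to their parents along C.
-- (⇐) Let D be the chain of S ∪ P through the first edge of P. Walking along
--     P: at an inner vertex z (new, so z ≠ r and S has no edge at z)
--     upwards-closure yields a chain through z (p z), which by (a) enters and
--     leaves z, hence uses both edges of P at z and by (b) equals D. So D
--     contains P; and no edge of D lies in S, else by (b) D would be a chain of
--     S and the first edge of P an edge of S. As D does not backtrack and P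
--     is a path, sharing all edges forces P = D up to direction.

open import Defs hiding (sym)
open import Data.Nat using (ℕ; zero; suc)
open import Data.Nat.Properties using (≤-antisym)
open import Data.Fin using (Fin)
open import Data.List using (List; []; _∷_; _++_; [_]; reverse)
open import Data.List.Properties
  using (++-assoc; ++-identityʳ; unfold-reverse; reverse-++; reverse-involutive; ∷-injective)
open import Data.List.Membership.Propositional using (_∈_; _∉_; find; lose)
open import Data.List.Membership.Propositional.Properties using (∈-++⁺ˡ; ∈-++⁺ʳ; ∈-++⁻)
open import Data.List.Relation.Unary.Any using (Any; here; there)
import Data.List.Relation.Unary.Any.Properties as Any
import Data.List.Relation.Unary.All as All
open import Data.List.Relation.Unary.AllPairs using (_∷_)
open import Data.List.Relation.Unary.Unique.Propositional using (Unique)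
open import Data.List.Relation.Binary.Subset.Propositional using (_⊆_)
open import Data.List.Relation.Binary.Permutation.Propositional using (↭-sym; ↭⇒↭ₛ)
open import Data.List.Relation.Binary.Permutation.Propositional.Properties using (↭-reverse)
import Data.List.Relation.Binary.Permutation.Setoid.Properties as PermutationSetoid
open import Data.Product using (∃; ∃₂; _×_; _,_; proj₁; proj₂)
open import Data.Sum using (_⊎_; inj₁; inj₂)
open import Data.Empty using (⊥; ⊥-elim)
open import Function.Bundles using (_⇔_; mk⇔; Equivalence)
open import Relation.Binary.PropositionalEquality
  using (_≡_; _≢_; refl; sym; trans; cong; subst; setoid; module ≡-Reasoning)
open import Relation.Nullary using (¬_)

module _ {A : Set} where

  consec-∈ˡ : ∀ {u v : A} {xs} → Consec u v xs → u ∈ xs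
  consec-∈ˡ here      = here refl
  consec-∈ˡ (there c) = there (consec-∈ˡ c)

  consec-∈ʳ : ∀ {u v : A} {xs} → Consec u v xs → v ∈ xs
  consec-∈ʳ here      = there (here refl)
  consec-∈ʳ (there c) = there (consec-∈ʳ c)

  consec-∈-tail : ∀ {u v h : A} {t} → Consec u v (h ∷ t) → v ∈ t
  consec-∈-tail here      = here refl
  consec-∈-tail (there c) = consec-∈ʳ c

  edge-∈ : ∀ {u v : A} {xs} → EdgeOf u v xs → u ∈ xs
  edge-∈ (inj₁ c) = consec-∈ˡ c
  edge-∈ (inj₂ c) = consec-∈ʳ c

  edge-sym : ∀ {u v : A} {xs} → EdgeOf u v xs → EdgeOf v u xs
  edge-sym (inj₁ c) = inj₂ c
  edge-sym (inj₂ c) = inj₁ c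

  consec-++ˡ : ∀ {u v : A} {xs ys} → Consec u v xs → Consec u v (xs ++ ys)
  consec-++ˡ here      = here
  consec-++ˡ (there c) = there (consec-++ˡ c)

  consec-++ʳ : ∀ {u v : A} xs {ys} → Consec u v ys → Consec u v (xs ++ ys)
  consec-++ʳ []       c = c
  consec-++ʳ (_ ∷ xs) c = there (consec-++ʳ xs c)

  consec-split : ∀ {u v : A} {xs} → Consec u v xs → ∃₂ λ pre R → xs ≡ pre ++ u ∷ v ∷ R
  consec-split (here {xs = R}) = [] , R , refl
  consec-split (there {x = x} c) with consec-split c
  ... | pre , R , refl = x ∷ pre , R , refl

  consec-init : ∀ {u v y : A} xs → Consec u v (xs ++ [ y ]) → u ∈ xs
  consec-init []            (there ())
  consec-init (x ∷ [])      here      = here refl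
  consec-init (x ∷ [])      (there c) = there (consec-init [] c)
  consec-init (x ∷ x' ∷ xs) here      = here refl
  consec-init (x ∷ x' ∷ xs) (there c) = there (consec-init (x' ∷ xs) c)

  consec-join : ∀ {d r : A} D {R} → ∃ λ l → l ∈ d ∷ D × Consec l r ((d ∷ D) ++ r ∷ R)
  consec-join []      = _ , here refl , here
  consec-join (x ∷ D) with consec-join D
  ... | l , l∈ , c = l , there l∈ , there c

  successor-in : ∀ {v : A} L {y} → v ∈ L → ∃ λ s → Consec v s (L ++ [ y ])
  successor-in (_ ∷ [])    (here refl) = _ , here
  successor-in (_ ∷ _ ∷ _) (here refl) = _ , here
  successor-in (_ ∷ L)     (there v∈)  = let (s , c) = successor-in L v∈ in s , there c

  entered-or-start : ∀ {z v : A} {L} → Consec z v L →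
                     (∃ λ q → Consec q z L) ⊎ (∃ λ t → L ≡ z ∷ v ∷ t)
  entered-or-start (here {xs = t}) = inj₂ (t , refl)
  entered-or-start (there {x = x} c) with entered-or-start c
  ... | inj₁ (q , qz)   = inj₁ (q , there qz)
  ... | inj₂ (_ , refl) = inj₁ (x , here)

  nonempty-snoc : ∀ (L : List A) y → ∃₂ λ h t → L ++ [ y ] ≡ h ∷ t
  nonempty-snoc []      y = y , [] , refl
  nonempty-snoc (h ∷ L) y = h , L ++ [ y ] , refl

  propagate : (Q : A → A → Set) {xs : List A} →
              (∀ {u v t} → xs ≡ u ∷ v ∷ t → Q u v) →
              (∀ {u v w} → Consec u v xs → Consec v w xs → Q u v → Q v w) →
              ∀ {u v} → Consec u v xs → Q u v
  propagate Q first pass here      = first refl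
  propagate Q first pass (there c) =
    propagate Q (λ { refl → pass here (there here) (first refl) })
                (λ c₁ c₂ → pass (there c₁) (there c₂)) c

  consec-reverse : ∀ {u v : A} {xs} → Consec u v xs → Consec v u (reverse xs)
  consec-reverse {u} {v} (here {xs = R})
    rewrite unfold-reverse u (v ∷ R) | unfold-reverse v R
          | ++-assoc (reverse R) [ v ] [ u ] = consec-++ʳ (reverse R) here
  consec-reverse (there {x = x} {xs = xs} c)
    rewrite unfold-reverse x xs = consec-++ˡ (consec-reverse c)

  consec-reverse⁻ : ∀ {u v : A} {xs} → Consec u v (reverse xs) → Consec v u xs
  consec-reverse⁻ {xs = xs} c = subst (Consec _ _) (reverse-involutive xs) (consec-reverse c)

  edge-reverse : ∀ {u v : A} {xs} → EdgeOf u v xs → EdgeOf u v (reverse xs)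
  edge-reverse (inj₁ c) = inj₂ (consec-reverse c)
  edge-reverse (inj₂ c) = inj₁ (consec-reverse c)

  reverse-ends : ∀ (x : A) mid y → reverse (x ∷ (mid ++ [ y ])) ≡ y ∷ (reverse mid ++ [ x ])
  reverse-ends x mid y = trans (reverse-++ (x ∷ mid) [ y ]) (cong (y ∷_) (unfold-reverse x mid))

  unique-head : ∀ {x : A} {xs} → Unique (x ∷ xs) → x ∉ xs
  unique-head (x∉ ∷ _) x∈ = All.lookup x∉ x∈ refl

  unique-disjoint : ∀ {x : A} xs {ys} → Unique (xs ++ ys) → x ∈ xs → x ∈ ys → ⊥
  unique-disjoint (_ ∷ xs) u       (here refl) x∈ys = unique-head u (∈-++⁺ʳ xs x∈ys)
  unique-disjoint (_ ∷ xs) (_ ∷ u) (there x∈)  x∈ys = unique-disjoint xs u x∈ x∈ys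

  unique-reverse : ∀ {xs : List A} → Unique xs → Unique (reverse xs)
  unique-reverse {xs} =
    PermutationSetoid.Unique-resp-↭ (setoid A) (↭⇒↭ₛ (↭-sym (↭-reverse xs)))

  successor-unique : ∀ {u v v' : A} {xs} → Unique xs →
                     Consec u v xs → Consec u v' xs → v ≡ v'
  successor-unique _       here      here       = refl
  successor-unique u       here      (there c)  = ⊥-elim (unique-head u (consec-∈ˡ c))
  successor-unique u       (there c) here       = ⊥-elim (unique-head u (consec-∈ˡ c))
  successor-unique (_ ∷ u) (there c) (there c') = successor-unique u c c'

  predecessor-unique : ∀ {u u' v : A} {xs} → Unique xs →
                       Consec u v xs → Consec u' v xs → u ≡ u'
  predecessor-unique _       here      here       = refl
  predecessor-unique (_ ∷ u) here      (there c)  = ⊥-elim (unique-head u (consec-∈-tail c))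
  predecessor-unique (_ ∷ u) (there c) here       = ⊥-elim (unique-head u (consec-∈-tail c))
  predecessor-unique (_ ∷ u) (there c) (there c') = predecessor-unique u c c'

  successor-at : ∀ {b c : A} {P} pre R → Unique P → P ≡ pre ++ b ∷ R →
                 Consec b c P → ∃ λ R' → R ≡ c ∷ R'
  successor-at pre []      u refl bc =
    ⊥-elim (unique-disjoint pre u (consec-init pre bc) (here refl))
  successor-at {b} pre (r ∷ R) u refl bc
    with successor-unique u bc (consec-++ʳ pre (here {u = b} {v = r}))
  ... | refl = R , refl

  entered-and-left⇒inner : ∀ {x y a z b : A} mid → Unique (x ∷ (mid ++ [ y ])) →
                           Consec a z (x ∷ (mid ++ [ y ])) → Consec z b (x ∷ (mid ++ [ y ])) →
                           z ∈ mid
  entered-and-left⇒inner mid u az zb with consec-init (_ ∷ mid) zb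
  ... | here refl = ⊥-elim (unique-head u (consec-∈-tail az))
  ... | there z∈  = z∈

  neighbour-of : ∀ {a z b w : A} {P} → Unique P → Consec a z P → Consec z b P →
                 EdgeOf z w P → w ≡ a ⊎ w ≡ b
  neighbour-of u az zb (inj₁ zw) = inj₂ (sym (successor-unique u zb zw))
  neighbour-of u az zb (inj₂ wz) = inj₁ (sym (predecessor-unique u az wz))

  both-neighbours : ∀ {a z b w w' : A} {L} → EdgeOf z w L → EdgeOf z w' L →
                    w ≡ a ⊎ w ≡ b → w' ≡ a ⊎ w' ≡ b → w ≢ w' → EdgeOf z a L × EdgeOf z b L
  both-neighbours zw zw' (inj₁ refl) (inj₂ refl) _    = zw , zw'
  both-neighbours zw zw' (inj₂ refl) (inj₁ refl) _    = zw' , zw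
  both-neighbours _  _   (inj₁ refl) (inj₁ refl) w≢w' = ⊥-elim (w≢w' refl)
  both-neighbours _  _   (inj₂ refl) (inj₂ refl) w≢w' = ⊥-elim (w≢w' refl)

  _⊑_ : List A → List A → Set
  xs ⊑ ys = ∀ {u v} → Consec u v xs → EdgeOf u v ys

  ⊑-edge : ∀ {xs ys : List A} {u v} → xs ⊑ ys → EdgeOf u v xs → EdgeOf u v ys
  ⊑-edge xs⊑ys (inj₁ uv) = xs⊑ys uv
  ⊑-edge xs⊑ys (inj₂ vu) = edge-sym (xs⊑ys vu)

  equal-up-to-reversal⇒same-edges : ∀ {P C : List A} → P ≡ C ⊎ P ≡ reverse C → P ⊑ C × C ⊑ P
  equal-up-to-reversal⇒same-edges (inj₁ refl) = inj₁ , inj₁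
  equal-up-to-reversal⇒same-edges (inj₂ refl) =
    (λ c → inj₂ (consec-reverse⁻ c)) , (λ c → inj₂ (consec-reverse c))

  data Consec₃ (a z b : A) : List A → Set where
    here  : ∀ {xs} → Consec₃ a z b (a ∷ z ∷ b ∷ xs)
    there : ∀ {x xs} → Consec₃ a z b xs → Consec₃ a z b (x ∷ xs)

  consec₃-pairs : ∀ {a z b : A} {xs} → Consec₃ a z b xs → Consec a z xs × Consec z b xs
  consec₃-pairs here      = here , there here
  consec₃-pairs (there t) = let (c , d) = consec₃-pairs t in there c , there d

  NoBacktrack : List A → Set
  NoBacktrack D = ∀ {a z b} → Consec₃ a z b D → a ≢ b

  continue-forward : ∀ {a b c : A} {P} → Unique P → a ≢ c →
                     Consec a b P → EdgeOf b c P → Consec b c P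
  continue-forward _ _   _  (inj₁ bc) = bc
  continue-forward u a≢c ab (inj₂ cb) = ⊥-elim (a≢c (predecessor-unique u ab cb))

  private
    snoc-shift : ∀ (pre : List A) a xs → pre ++ a ∷ xs ≡ (pre ++ [ a ]) ++ xs
    snoc-shift pre a xs = sym (++-assoc pre [ a ] xs)

  segment : ∀ {P : List A} → Unique P → ∀ D {a b} → NoBacktrack (a ∷ b ∷ D) →
            (a ∷ b ∷ D) ⊑ P → ∀ pre R → P ≡ pre ++ a ∷ b ∷ R →
            ∃ λ R' → P ≡ pre ++ (a ∷ b ∷ D) ++ R'
  segment u []      nb D⊑P pre R eq = R , eq
  segment u (c ∷ D) {a} {b} nb D⊑P pre R eq
    with successor-at (pre ++ [ a ]) R u (trans eq (snoc-shift pre a _))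
           (continue-forward u (nb here) (subst (Consec a b) (sym eq) (consec-++ʳ pre here))
                             (D⊑P (there here)))
  ... | R' , refl
    with segment u D (λ t → nb (there t)) (λ c → D⊑P (there c)) (pre ++ [ a ]) R'
                 (trans eq (snoc-shift pre a _))
  ... | R'' , eq' = R'' , trans eq' (sym (snoc-shift pre a _))

  -- If moreover every edge of P lies on the walk, the segment is all of P:
  -- a vertex of P just before or just after it would be repeated in P.
  forward-equal : ∀ {P : List A} {d₀ d₁ D} → Unique P → NoBacktrack (d₀ ∷ d₁ ∷ D) →
                  (d₀ ∷ d₁ ∷ D) ⊑ P → P ⊑ (d₀ ∷ d₁ ∷ D) → Consec d₀ d₁ P →
                  P ≡ d₀ ∷ d₁ ∷ D
  forward-equal {P} {d₀} {d₁} {D} u nb D⊑P P⊑D c with consec-split c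
  ... | pre , R , eq with segment u D nb D⊑P pre R eq
  ... | R' , eq' = nothing-around pre R' eq'
    where
    W : List A
    W = d₀ ∷ d₁ ∷ D
    nothing-around : ∀ pre R' → P ≡ pre ++ W ++ R' → P ≡ W
    nothing-around []        []       eq' = trans eq' (++-identityʳ W)
    nothing-around []        (r ∷ R') eq' with consec-join (d₁ ∷ D) {R = R'}
    ... | l , _ , lr = ⊥-elim (unique-disjoint W (subst Unique eq' u)
            (edge-∈ (edge-sym (P⊑D (subst (Consec l r) (sym eq') lr)))) (here refl))
    nothing-around (q ∷ pre) R'       eq' with consec-join {r = d₀} pre {R = d₁ ∷ D ++ R'}
    ... | l , l∈ , ld₀ = ⊥-elim (unique-disjoint (q ∷ pre) (subst Unique eq' u) l∈
            (∈-++⁺ˡ (edge-∈ (P⊑D (subst (Consec l d₀) (sym eq') ld₀)))))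

  same-edges⇒equal-up-to-reversal :
    ∀ {P D : List A} {u v} → Unique P → NoBacktrack D → D ⊑ P → P ⊑ D → EdgeOf u v D →
    P ≡ D ⊎ P ≡ reverse D
  same-edges⇒equal-up-to-reversal {P} {D = D@(_ ∷ _ ∷ _)} u nb D⊑P P⊑D _ with D⊑P here
  ... | inj₁ c = inj₁ (forward-equal u nb D⊑P P⊑D c)
  ... | inj₂ c = inj₂ (begin
      P                    ≡⟨ sym (reverse-involutive P) ⟩
      reverse (reverse P)  ≡⟨ cong reverse (forward-equal (unique-reverse u) nb
                                (λ c' → edge-reverse (D⊑P c'))
                                (λ c' → edge-sym (P⊑D (consec-reverse⁻ c')))
                                (consec-reverse c)) ⟩
      reverse D            ∎)
    where open ≡-Reasoning
  same-edges⇒equal-up-to-reversal {D = _ ∷ []} _ _ _ _ (inj₁ (there ()))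
  same-edges⇒equal-up-to-reversal {D = _ ∷ []} _ _ _ _ (inj₂ (there ()))
  same-edges⇒equal-up-to-reversal {D = []}     _ _ _ _ (inj₁ ())
  same-edges⇒equal-up-to-reversal {D = []}     _ _ _ _ (inj₂ ())

iter-shift : ∀ {A : Set} (f : A → A) k a → iter f k (f a) ≡ f (iter f k a)
iter-shift f zero    a = refl
iter-shift f (suc k) a = cong f (iter-shift f k a)

module TreeFacts {n : ℕ} {G : Graph n} (T : DFSTree G) where

  p : Fin n → Fin n
  p = parent T

  r : Fin n
  r = root T

  ancestor-of-parent : ∀ {u w} → Ancestor T u (p w) → Ancestor T u w
  ancestor-of-parent {u} {w} (k , pᵏ⁺¹w≡u) = suc k , trans (sym (iter-shift p k w)) pᵏ⁺¹w≡u

  parent-ancestor : ∀ w → Ancestor T (p w) w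
  parent-ancestor w = 1 , refl

  ancestor-antisym : ∀ {u v} → Ancestor T u v → Ancestor T v u → u ≡ v
  ancestor-antisym {u} {v} uv vu =
    dfi-inj T u v (≤-antisym (dfi-anc T u v uv) (dfi-anc T v u vu))

  mutual-ancestors-nonadjacent : ∀ {u v} → Ancestor T u v → Ancestor T v u → ¬ Adj G u v
  mutual-ancestors-nonadjacent uv vu adj with ancestor-antisym uv vu
  ... | refl = irrefl G adj

  ancestor-of-root : ∀ {u} → Ancestor T u r → u ≡ r
  ancestor-of-root (k , pᵏr≡u) = trans (sym pᵏr≡u) (iter-root k)
    where
    iter-root : ∀ k → iter p k r ≡ r
    iter-root zero    = refl
    iter-root (suc k) = trans (cong p (iter-root k)) (parent-root T)

  grandparent-distinct : ∀ {z} → z ≢ r → p (p z) ≢ z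
  grandparent-distinct {z} z≢r ppz≡z =
    mutual-ancestors-nonadjacent (1 , ppz≡z) (parent-ancestor z) (tree-edge T z z≢r)

  no-backedge-to-parent : ∀ {y} → ¬ Backedge T y (p y)
  no-backedge-to-parent {y} (adj , y-anc , _) =
    mutual-ancestors-nonadjacent y-anc (parent-ancestor y) adj

  UpWalk : List (Fin n) → Set
  UpWalk xs = ∀ {u v} → Consec u v xs → v ≡ p u × u ≢ r

  upWalk-tail : ∀ {h t} → UpWalk (h ∷ t) → UpWalk t
  upWalk-tail up c = up (there c)

  upWalk-no-backtrack : ∀ {xs} → UpWalk xs → NoBacktrack xs
  upWalk-no-backtrack up t a≡b with consec₃-pairs t
  ... | az , zb with up az | up zb
  ...   | z≡pa , a≢r | b≡pz , _ =
    grandparent-distinct a≢r (sym (trans a≡b (trans b≡pz (cong p z≡pa))))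

  treePath-head : ∀ {w u ps} → TreePath T w u ps → ∃ λ t → ps ≡ w ∷ t
  treePath-head stop       = _ , refl
  treePath-head (step _ _) = _ , refl

  treePath-ancestor : ∀ {w u ps} → TreePath T w u ps → Ancestor T u w
  treePath-ancestor stop        = 0 , refl
  treePath-ancestor (step _ tp) = ancestor-of-parent (treePath-ancestor tp)

  treePath-consec : ∀ {w u ps y z} → TreePath T w u ps → Consec y z ps →
                    z ≡ p y × y ≢ u × Ancestor T y w × Ancestor T u y
  treePath-consec stop (there ())
  treePath-consec (step w≢u tp) here with treePath-head tp
  ... | _ , refl = refl , w≢u , (0 , refl) , treePath-ancestor (step w≢u tp)
  treePath-consec (step _ tp) (there c) with treePath-consec tp c
  ... | z≡py , y≢u , y-anc , u-anc = z≡py , y≢u , ancestor-of-parent y-anc , u-anc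

  treePath-upWalk : ∀ {w u ps} → TreePath T w u ps → UpWalk ps
  treePath-upWalk tp c with treePath-consec tp c
  ... | z≡py , y≢u , _ , u-anc = z≡py , λ y≡r →
    y≢u (trans y≡r (sym (ancestor-of-root (subst (Ancestor T _) y≡r u-anc))))

  upTo-head : ∀ {Cov w ps} → UpTo T Cov w ps → ∃ λ t → ps ≡ w ∷ t
  upTo-head (stop _)   = _ , refl
  upTo-head (step _ _) = _ , refl

  upTo-consec : ∀ {Cov w ps y z} → UpTo T Cov w ps → Consec y z ps → z ≡ p y × ¬ Cov y
  upTo-consec (stop _) (there ())
  upTo-consec (step ¬cov up) here with upTo-head up
  ... | _ , refl = refl , ¬cov
  upTo-consec (step _ up) (there c) = upTo-consec up c

  -- as the root is covered, an UpTo path stops at the root at the latest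
  upTo-upWalk : ∀ {Cov w ps} → Cov r → UpTo T Cov w ps → UpWalk ps
  upTo-upWalk cov-r up c with upTo-consec up c
  ... | z≡py , ¬cov = z≡py , λ y≡r → ¬cov (subst _ (sym y≡r) cov-r)

module BuildFacts {n : ℕ} {G : Graph n} (T : DFSTree G) where
  open TreeFacts T

  built-shape : ∀ {Cov es rest D} → Cov r → Build T Cov es rest → D ∈ rest →
                ∃ λ h → ∃ λ t₀ → ∃ λ t → D ≡ h ∷ t₀ ∷ t × (h , t₀) ∈ es × UpWalk (t₀ ∷ t)
  built-shape cov-r (up ∷ b) (here refl) with upTo-head up
  ... | t , refl = _ , _ , t , refl , here refl , upTo-upWalk cov-r up
  built-shape cov-r (up ∷ b) (there i) with built-shape (inj₁ cov-r) b i
  ... | h , t₀ , t , eq , e∈ , up' = h , t₀ , t , eq , there e∈ , up'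

  built-head : ∀ {Cov es rest h t₀ t} → Build T Cov es rest → (h ∷ t₀ ∷ t) ∈ rest →
               (h , t₀) ∈ es
  built-head (up ∷ b) (here refl) with upTo-head up
  ... | _ , refl = here refl
  built-head (up ∷ b) (there i) = there (built-head b i)

  built-fresh : ∀ {Cov es rest h t y z} → Build T Cov es rest → (h ∷ t) ∈ rest →
                Consec y z t → ¬ Cov y
  built-fresh (up ∷ b) (here refl) c     = proj₂ (upTo-consec up c)
  built-fresh (up ∷ b) (there i)   c cov = built-fresh b i c (inj₁ cov)

  built-fresh-unique : ∀ {Cov es rest h t h' t' y z z'} → Build T Cov es rest →
                       (h ∷ t) ∈ rest → (h' ∷ t') ∈ rest →
                       Consec y z t → Consec y z' t' → h ∷ t ≡ h' ∷ t'
  built-fresh-unique (up ∷ b) (here refl) (here refl) _ _  = refl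
  built-fresh-unique (up ∷ b) (here refl) (there i')  c c' =
    ⊥-elim (built-fresh b i' c' (inj₂ (there (consec-∈ˡ c))))
  built-fresh-unique (up ∷ b) (there i)   (here refl) c c' =
    ⊥-elim (built-fresh b i c (inj₂ (there (consec-∈ˡ c'))))
  built-fresh-unique (up ∷ b) (there i)   (there i')  c c' = built-fresh-unique b i i' c c'

  built-head-unique : ∀ {Cov es rest h t₀ t t'} → Build T Cov es rest → Unique es →
                      (h ∷ t₀ ∷ t) ∈ rest → (h ∷ t₀ ∷ t') ∈ rest → t ≡ t'
  built-head-unique (up ∷ b) _ (here refl) (here refl) = refl
  built-head-unique (up ∷ b) u (here refl) (there i') with upTo-head up
  ... | _ , refl = ⊥-elim (unique-head u (built-head b i'))
  built-head-unique (up ∷ b) u (there i) (here refl) with upTo-head up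
  ... | _ , refl = ⊥-elim (unique-head u (built-head b i))
  built-head-unique (up ∷ b) (_ ∷ u) (there i) (there i') = built-head-unique b u i i'

module ChainFacts {n : ℕ} {G : Graph n} (T : DFSTree G) {Cs : List (List (Fin n))}
                  (dec : IsChainDecomposition T Cs) where
  open TreeFacts T
  open BuildFacts T
  open IsChainDecomposition dec

  Cov₀ : Fin n → Set
  Cov₀ u = u ∈ C0 ⊎ u ∈ (root T ∷ c1) ⊎ u ∈ (root T ∷ c2)

  cov₀-root : Cov₀ r
  cov₀-root = inj₂ (inj₁ (here refl))

  data Position : List (Fin n) → Set where
    chain₀ : Position C0
    chain₁ : Position (r ∷ c1)
    chain₂ : Position (r ∷ c2)
    later  : ∀ {D} → D ∈ rest → Position D

  position : ∀ {D} → D ∈ Cs → Position D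
  position i with subst (_ ∈_) Cs-eq i
  ... | here refl                 = chain₀
  ... | there (here refl)         = chain₁
  ... | there (there (here refl)) = chain₂
  ... | there (there (there j))   = later j

  data ChainShape : List (Fin n) → Set where
    root-chain : ∀ {D} → D ≡ C0 → UpWalk D → ChainShape D
    back-chain : ∀ {h t₀ t} → Backedge T h t₀ → UpWalk (t₀ ∷ t) → ChainShape (h ∷ t₀ ∷ t)

  first-chain-shape : ∀ {c w} → TreePath T w x c → Backedge T r w → ChainShape (r ∷ c)
  first-chain-shape tp be with treePath-head tp
  ... | _ , refl = back-chain be (treePath-upWalk tp)

  chain-shape : ∀ {D} → D ∈ Cs → ChainShape D
  chain-shape i with position i
  ... | chain₀ = root-chain refl (treePath-upWalk C0-path)
  ... | chain₁ = first-chain-shape c1-path ra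
  ... | chain₂ = first-chain-shape c2-path rb
  ... | later j with built-shape cov₀-root build j
  ...   | h , t₀ , t , refl , e∈ , up = back-chain (All.lookup es-back e∈) up

  data StepKind (D : List (Fin n)) (u v : Fin n) : Set where
    tree-step  : v ≡ p u → u ≢ r → StepKind D u v
    first-step : ∀ {t} → D ≡ u ∷ v ∷ t → Backedge T u v → StepKind D u v

  step-kind : ∀ {D u v} → D ∈ Cs → Consec u v D → StepKind D u v
  step-kind i c with chain-shape i
  ... | root-chain _ up                = let (v≡pu , u≢r) = up c in tree-step v≡pu u≢r
  ... | back-chain be up with c
  ...   | here     = first-step refl be
  ...   | there c' = let (v≡pu , u≢r) = up c' in tree-step v≡pu u≢r

  chain-tail-upWalk : ∀ {h t} → (h ∷ t) ∈ Cs → UpWalk t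
  chain-tail-upWalk i with chain-shape i
  ... | root-chain _ up = upWalk-tail up
  ... | back-chain _ up = up

  -- the backedge h t₀ cannot be followed by the tree edge back to h
  chain-no-backtrack : ∀ {D} → D ∈ Cs → NoBacktrack D
  chain-no-backtrack i with chain-shape i
  ... | root-chain _ up = upWalk-no-backtrack up
  ... | back-chain (_ , _ , pt₀≢h) up = λ where
    here      h≡pt₀ → pt₀≢h (sym (trans h≡pt₀ (proj₁ (up here))))
    (there t)       → upWalk-no-backtrack up t

  -- Where a tree edge y (p y) can lie: the chain owning it is determined by y.
  data TreeEdgeSite (y : Fin n) : List (Fin n) → Set where
    on-C₀    : Cov₀ y → Ancestor T y x → TreeEdgeSite y C0
    on-C₁    : Cov₀ y → y ≢ x → Ancestor T y a → Ancestor T x y → TreeEdgeSite y (r ∷ c1)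
    on-C₂    : Cov₀ y → y ≢ x → Ancestor T y b → Ancestor T x y → TreeEdgeSite y (r ∷ c2)
    on-later : ∀ {h t z} → (h ∷ t) ∈ rest → Consec y z t → ¬ Cov₀ y → TreeEdgeSite y (h ∷ t)

  first-chain-tree-edge : ∀ {y c w} → TreePath T w x c → Backedge T r w →
                          Consec y (p y) (r ∷ c) →
                          Consec y (p y) c × y ≢ x × Ancestor T y w × Ancestor T x y
  first-chain-tree-edge {y} tp be c with treePath-head tp
  ... | _ , refl with c
  ...   | here     = ⊥-elim (no-backedge-to-parent be)
  ...   | there c' = c' , proj₂ (treePath-consec tp c')

  -- the site of a tree edge of a chain (its first edge is a backedge unless it is C₀)
  tree-edge-site : ∀ {D y} → D ∈ Cs → Consec y (p y) D → TreeEdgeSite y D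
  tree-edge-site i c with position i
  ... | chain₀ = on-C₀ (inj₁ (consec-∈ˡ c)) (proj₁ (proj₂ (proj₂ (treePath-consec C0-path c))))
  ... | chain₁ = let (c' , y≢x , y-anc , x-anc) = first-chain-tree-edge c1-path ra c in
                 on-C₁ (inj₂ (inj₁ (there (consec-∈ˡ c')))) y≢x y-anc x-anc
  ... | chain₂ = let (c' , y≢x , y-anc , x-anc) = first-chain-tree-edge c2-path rb c in
                 on-C₂ (inj₂ (inj₂ (there (consec-∈ˡ c')))) y≢x y-anc x-anc
  ... | later j with built-shape cov₀-root build j
  ...   | h , t₀ , t , refl , e∈ , _ with c
  ...     | here     = ⊥-elim (no-backedge-to-parent (All.lookup es-back e∈))
  ...     | there c' = on-later j c' (built-fresh build j c')

  -- a vertex strictly between x and a, and also between x and b, would be a common ancestor below x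
  below-lca : ∀ {y} → y ≢ x → Ancestor T y a → Ancestor T y b → Ancestor T x y → ⊥
  below-lca y≢x y-a y-b x-y = y≢x (ancestor-antisym (proj₂ (proj₂ lca) _ y-a y-b) x-y)

  tree-edge-owner-unique : ∀ {D D' y} → D ∈ Cs → D' ∈ Cs →
                           Consec y (p y) D → Consec y (p y) D' → D ≡ D'
  tree-edge-owner-unique i i' c c' = same-site (tree-edge-site i c) (tree-edge-site i' c')
    where
    same-site : ∀ {y D D'} → TreeEdgeSite y D → TreeEdgeSite y D' → D ≡ D'
    same-site (on-C₀ _ _)           (on-C₀ _ _)           = refl
    same-site (on-C₁ _ _ _ _)       (on-C₁ _ _ _ _)       = refl
    same-site (on-C₂ _ _ _ _)       (on-C₂ _ _ _ _)       = refl
    same-site (on-C₀ _ y-x)         (on-C₁ _ y≢x _ x-y)   = ⊥-elim (y≢x (ancestor-antisym y-x x-y))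
    same-site (on-C₀ _ y-x)         (on-C₂ _ y≢x _ x-y)   = ⊥-elim (y≢x (ancestor-antisym y-x x-y))
    same-site (on-C₁ _ y≢x _ x-y)   (on-C₀ _ y-x)         = ⊥-elim (y≢x (ancestor-antisym y-x x-y))
    same-site (on-C₂ _ y≢x _ x-y)   (on-C₀ _ y-x)         = ⊥-elim (y≢x (ancestor-antisym y-x x-y))
    same-site (on-C₁ _ y≢x y-a x-y) (on-C₂ _ _ y-b _)     = ⊥-elim (below-lca y≢x y-a y-b x-y)
    same-site (on-C₂ _ y≢x y-b x-y) (on-C₁ _ _ y-a _)     = ⊥-elim (below-lca y≢x y-a y-b x-y)
    same-site (on-later j c _)      (on-later j' c' _)    = built-fresh-unique build j j' c c'
    same-site (on-C₀ cov _)         (on-later _ _ ¬cov)   = ⊥-elim (¬cov cov)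
    same-site (on-C₁ cov _ _ _)     (on-later _ _ ¬cov)   = ⊥-elim (¬cov cov)
    same-site (on-C₂ cov _ _ _)     (on-later _ _ ¬cov)   = ⊥-elim (¬cov cov)
    same-site (on-later _ _ ¬cov)   (on-C₀ cov _)         = ⊥-elim (¬cov cov)
    same-site (on-later _ _ ¬cov)   (on-C₁ cov _ _ _)     = ⊥-elim (¬cov cov)
    same-site (on-later _ _ ¬cov)   (on-C₂ cov _ _ _)     = ⊥-elim (¬cov cov)

  data BackedgeSite (h t₀ : Fin n) : List (Fin n) → Set where
    first-of-C₁ : h ≡ r → t₀ ≡ a → BackedgeSite h t₀ (r ∷ c1)
    first-of-C₂ : h ≡ r → t₀ ≡ b → BackedgeSite h t₀ (r ∷ c2)
    first-later : ∀ {t} → (h ∷ t₀ ∷ t) ∈ rest → BackedgeSite h t₀ (h ∷ t₀ ∷ t)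

  first-chain-head : ∀ {h t₀ t c w} → TreePath T w x c → r ∷ c ≡ h ∷ t₀ ∷ t → h ≡ r × t₀ ≡ w
  first-chain-head tp eq with treePath-head tp | ∷-injective eq
  ... | _ , refl | h≡r , c≡ = sym h≡r , sym (proj₁ (∷-injective c≡))

  -- C₀ starts with a tree edge, so a chain starting with a backedge is C₁, C₂ or a later one
  backedge-site : ∀ {D h t₀ t} → D ∈ Cs → D ≡ h ∷ t₀ ∷ t → Backedge T h t₀ → BackedgeSite h t₀ D
  backedge-site {h = h} i eq be with position i
  ... | chain₀  = ⊥-elim (no-backedge-to-parent (subst (Backedge T h)
                    (proj₁ (treePath-upWalk C0-path (subst (Consec _ _) (sym eq) here))) be))
  ... | chain₁  = let (h≡r , t₀≡a) = first-chain-head c1-path eq in first-of-C₁ h≡r t₀≡a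
  ... | chain₂  = let (h≡r , t₀≡b) = first-chain-head c2-path eq in first-of-C₂ h≡r t₀≡b
  ... | later j with eq
  ...   | refl = first-later j

  backedge-owner-unique : ∀ {D D' h t₀ t t'} → D ∈ Cs → D' ∈ Cs →
                          D ≡ h ∷ t₀ ∷ t → D' ≡ h ∷ t₀ ∷ t' → Backedge T h t₀ → D ≡ D'
  backedge-owner-unique i i' eq eq' be = same-site (backedge-site i eq be) (backedge-site i' eq' be)
    where
    not-later-C₁ : ∀ {h t₀ t} → h ≡ r → t₀ ≡ a → (h ∷ t₀ ∷ t) ∈ rest → ⊥
    not-later-C₁ refl refl j = es-ra (built-head build j)
    not-later-C₂ : ∀ {h t₀ t} → h ≡ r → t₀ ≡ b → (h ∷ t₀ ∷ t) ∈ rest → ⊥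
    not-later-C₂ refl refl j = es-rb (built-head build j)
    same-site : ∀ {h t₀ D D'} → BackedgeSite h t₀ D → BackedgeSite h t₀ D' → D ≡ D'
    same-site (first-of-C₁ _ _)      (first-of-C₁ _ _)      = refl
    same-site (first-of-C₂ _ _)      (first-of-C₂ _ _)      = refl
    same-site (first-of-C₁ _ t₀≡a)   (first-of-C₂ _ t₀≡b)   = ⊥-elim (a≢b (trans (sym t₀≡a) t₀≡b))
    same-site (first-of-C₂ _ t₀≡b)   (first-of-C₁ _ t₀≡a)   = ⊥-elim (a≢b (trans (sym t₀≡a) t₀≡b))
    same-site (first-of-C₁ h≡r t₀≡a) (first-later j)        = ⊥-elim (not-later-C₁ h≡r t₀≡a j)
    same-site (first-later j)        (first-of-C₁ h≡r t₀≡a) = ⊥-elim (not-later-C₁ h≡r t₀≡a j)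
    same-site (first-of-C₂ h≡r t₀≡b) (first-later j)        = ⊥-elim (not-later-C₂ h≡r t₀≡b j)
    same-site (first-later j)        (first-of-C₂ h≡r t₀≡b) = ⊥-elim (not-later-C₂ h≡r t₀≡b j)
    same-site (first-later j)        (first-later j')       =
      cong (λ t → _ ∷ _ ∷ t) (built-head-unique build es-uniq j j')

  no-opposite-steps : ∀ {D D' u v} → D ∈ Cs → D' ∈ Cs → Consec u v D → Consec v u D' → ⊥
  no-opposite-steps i i' uv vu with step-kind i uv | step-kind i' vu
  ... | tree-step refl u≢r | tree-step u≡ppu _  = grandparent-distinct u≢r (sym u≡ppu)
  ... | tree-step refl _   | first-step _ (_ , _ , pu≢pu) = pu≢pu refl
  ... | first-step _ (_ , _ , pv≢pv) | tree-step refl _ = pv≢pv refl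
  ... | first-step _ (adj , u-v , _) | first-step _ (_ , v-u , _) =
    mutual-ancestors-nonadjacent u-v v-u adj

  same-step-owner-unique : ∀ {D D' u v} → D ∈ Cs → D' ∈ Cs → Consec u v D → Consec u v D' → D ≡ D'
  same-step-owner-unique i i' uv uv' with step-kind i uv | step-kind i' uv'
  ... | tree-step refl _  | tree-step _ _     = tree-edge-owner-unique i i' uv uv'
  ... | tree-step refl _  | first-step _ be   = ⊥-elim (no-backedge-to-parent be)
  ... | first-step _ be   | tree-step refl _  = ⊥-elim (no-backedge-to-parent be)
  ... | first-step eq be  | first-step eq' _ = backedge-owner-unique i i' eq eq' be

  chains-edge-disjoint : ∀ {D D' u v} → D ∈ Cs → D' ∈ Cs → EdgeOf u v D → EdgeOf u v D' → D ≡ D'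
  chains-edge-disjoint i i' (inj₁ uv) (inj₁ uv') = same-step-owner-unique i i' uv uv'
  chains-edge-disjoint i i' (inj₂ vu) (inj₂ vu') = same-step-owner-unique i i' vu vu'
  chains-edge-disjoint i i' (inj₁ uv) (inj₂ vu)  = ⊥-elim (no-opposite-steps i i' uv vu)
  chains-edge-disjoint i i' (inj₂ vu) (inj₁ uv)  = ⊥-elim (no-opposite-steps i' i uv vu)

  sequence-contains-C₀ : ∀ {S'} → InSequence T Cs S' → ∀ {u v} → Consec u v C0 → S' u v
  sequence-contains-C₀ (base e) c with trans (sym e) Cs-eq
  ... | refl = here c
  sequence-contains-C₀ (add s _) c = inj₁ (sequence-contains-C₀ s c)

  sequence-contains-root : ∀ {S'} → InSequence T Cs S' → VertexOf S' r
  sequence-contains-root (base e) with trans (sym e) Cs-eq | treePath-head c1-path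
  ... | refl | _ , c1≡ = a , inj₁ (there (here (subst (λ c → Consec r a (r ∷ c)) (sym c1≡) here)))
  sequence-contains-root (add s _) with sequence-contains-root s
  ... | u , inj₁ ru = u , inj₁ (inj₁ ru)
  ... | u , inj₂ ur = u , inj₂ (inj₁ ur)

  tree-edge-upwards : ∀ {D z} → D ∈ Cs → z ≢ r → EdgeOf z (p z) D → Consec z (p z) D
  tree-edge-upwards _ _   (inj₁ c) = c
  tree-edge-upwards i z≢r (inj₂ c) with step-kind i c
  ... | tree-step z≡ppz _            = ⊥-elim (grandparent-distinct z≢r (sym z≡ppz))
  ... | first-step _ (_ , _ , pz≢pz) = ⊥-elim (pz≢pz refl)

  tree-step-entered : ∀ {D z} → D ∈ Cs → Consec z (p z) D →
                      (∃ λ q → Consec q z D) ⊎ Consec z (p z) C0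
  tree-step-entered i c with entered-or-start c
  ... | inj₁ entered = inj₁ entered
  ... | inj₂ (_ , eq) with chain-shape i | eq
  ...   | root-chain D≡C0 _ | _    = inj₂ (subst (Consec _ _) D≡C0 c)
  ...   | back-chain be _   | refl = ⊥-elim (no-backedge-to-parent be)

  predecessor-not-parent : ∀ {D q z} → D ∈ Cs → z ≢ r → Consec q z D → q ≢ p z
  predecessor-not-parent i z≢r qz with step-kind i qz
  ... | tree-step z≡pq _ = λ q≡pz →
    grandparent-distinct z≢r (trans (cong p (sym q≡pz)) (sym z≡pq))
  ... | first-step _ (_ , _ , pz≢q) = λ q≡pz → pz≢q (sym q≡pz)

  chain-inner-step : ∀ {C h L z v} → C ∈ Cs → C ≡ h ∷ (L ++ [ z ]) → v ∈ L → Consec v (p v) C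
  chain-inner-step {L = L} i refl v∈ with successor-in L v∈
  ... | s , vs with chain-tail-upWalk i vs
  ...   | refl , _ = there vs

-- The part of the definition of a BG-path used below: P runs from a vertex
-- of S through new vertices and new edges back to a vertex of S.
record Attachment {n : ℕ} (S : Sub n) (P : List (Fin n)) : Set where
  field
    start end  : Fin n
    interior   : List (Fin n)
    P-shape    : P ≡ start ∷ (interior ++ [ end ])
    P-unique   : Unique P
    start∈S    : VertexOf S start
    end∈S      : VertexOf S end
    inner∉S    : ∀ v → Inner v P → ¬ VertexOf S v
    edges∉S    : ∀ u v → Consec u v P → ¬ SEdge S u v

bg-attachment : ∀ {n} {G : Graph n} {S P} → IsBGPath G S P → Attachment S P
bg-attachment (x , y , (mid , eq) , (_ , uniq , _) , (x∈S , y∈S , inner∉S , edges∉S) , _) =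
  record { start = x ; end = y ; interior = mid ; P-shape = eq ; P-unique = uniq
         ; start∈S = x∈S ; end∈S = y∈S ; inner∉S = inner∉S ; edges∉S = edges∉S }

module Extension {n : ℕ} {G : Graph n} (T : DFSTree G) {Cs : List (List (Fin n))}
                 (dec : IsChainDecomposition T Cs) {S : Sub n} (sq : InSequence T Cs S)
                 (uc : UpwardsClosed T S) (mod : Modular T Cs S)
                 {P : List (Fin n)} (att : Attachment S P) where
  open TreeFacts T
  open ChainFacts T dec
  open Attachment att

  Ds : List (List (Fin n))
  Ds = proj₁ mod

  Ds⊆Cs : Ds ⊆ Cs
  Ds⊆Cs = proj₁ (proj₂ mod)

  S-chains : ∀ u v → SEdge S u v ⇔ Any (EdgeOf u v) Ds
  S-chains = proj₂ (proj₂ mod)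

  lift-S : ∀ {u v} → SEdge S u v → SEdge (S ∪P P) u v
  lift-S (inj₁ s) = inj₁ (inj₁ s)
  lift-S (inj₂ s) = inj₂ (inj₁ s)

  lift-P : ∀ {u v} → EdgeOf u v P → SEdge (S ∪P P) u v
  lift-P (inj₁ c) = inj₁ (inj₂ c)
  lift-P (inj₂ c) = inj₂ (inj₂ c)

  split-edge : ∀ {u v} → SEdge (S ∪P P) u v → SEdge S u v ⊎ EdgeOf u v P
  split-edge (inj₁ (inj₁ s)) = inj₁ (inj₁ s)
  split-edge (inj₂ (inj₁ s)) = inj₁ (inj₂ s)
  split-edge (inj₁ (inj₂ c)) = inj₂ (inj₁ c)
  split-edge (inj₂ (inj₂ c)) = inj₂ (inj₂ c)

  -- If P is the chain C (in either direction), S ∪ P is again modular and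
  -- upwards-closed: the inner vertices of P are left towards their parents.
  module ChainExtension {C : List (Fin n)} (C∈Cs : C ∈ Cs) (P≈C : P ≡ C ⊎ P ≡ reverse C) where

    P⊑C : P ⊑ C
    P⊑C = proj₁ (equal-up-to-reversal⇒same-edges P≈C)

    C⊑P : C ⊑ P
    C⊑P = proj₂ (equal-up-to-reversal⇒same-edges P≈C)

    modular : Modular T Cs (S ∪P P)
    modular = C ∷ Ds , C∷Ds⊆Cs , λ u v → mk⇔ to from
      where
      C∷Ds⊆Cs : (C ∷ Ds) ⊆ Cs
      C∷Ds⊆Cs (here refl) = C∈Cs
      C∷Ds⊆Cs (there i)   = Ds⊆Cs i
      to : ∀ {u v} → SEdge (S ∪P P) u v → Any (EdgeOf u v) (C ∷ Ds)
      to e with split-edge e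
      ... | inj₁ s = there (Equivalence.to (S-chains _ _) s)
      ... | inj₂ p = here (⊑-edge P⊑C p)
      from : ∀ {u v} → Any (EdgeOf u v) (C ∷ Ds) → SEdge (S ∪P P) u v
      from (here e)  = lift-P (⊑-edge C⊑P e)
      from (there e) = lift-S (Equivalence.from (S-chains _ _) e)

    C-shape : P ≡ C ⊎ P ≡ reverse C →
              ∃₂ λ h z → ∃ λ L → C ≡ h ∷ (L ++ [ z ]) × (∀ {v} → v ∈ interior → v ∈ L)
    C-shape (inj₁ P≡C)  = start , end , interior , trans (sym P≡C) P-shape , λ v∈ → v∈
    C-shape (inj₂ P≡C⁻) = end , start , reverse interior , C≡ , Any.reverse⁺
      where
      open ≡-Reasoning
      C≡ : C ≡ end ∷ (reverse interior ++ [ start ])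
      C≡ = begin
        C                                       ≡⟨ sym (reverse-involutive C) ⟩
        reverse (reverse C)                     ≡⟨ cong reverse (sym P≡C⁻) ⟩
        reverse P                               ≡⟨ cong reverse P-shape ⟩
        reverse (start ∷ (interior ++ [ end ])) ≡⟨ reverse-ends start interior end ⟩
        end ∷ (reverse interior ++ [ start ])   ∎

    interior-step : ∀ {v} → v ∈ interior → Consec v (p v) C
    interior-step v∈ = let (_ , _ , _ , C≡ , ⊆L) = C-shape P≈C in chain-inner-step C∈Cs C≡ (⊆L v∈)

    upwards-closed : UpwardsClosed T (S ∪P P)
    upwards-closed v (w , vw) v≢r with split-edge vw
    ... | inj₁ s = lift-S (uc v (w , s) v≢r)
    ... | inj₂ e with subst (v ∈_) P-shape (edge-∈ e)
    ...   | here refl  = lift-S (uc v start∈S v≢r)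
    ...   | there v∈ with ∈-++⁻ interior v∈
    ...     | inj₁ v∈interior = lift-P (⊑-edge C⊑P (inj₁ (interior-step v∈interior)))
    ...     | inj₂ (here refl) = lift-S (uc v end∈S v≢r)

  -- Conversely, if S ∪ P is upwards-closed and the union of the chains Ds',
  -- then P is the chain of Ds' through its first edge.
  module ModularExtension (uc' : UpwardsClosed T (S ∪P P)) (Ds' : List (List (Fin n)))
                          (Ds'⊆Cs : Ds' ⊆ Cs)
                          (chains' : ∀ u v → SEdge (S ∪P P) u v ⇔ Any (EdgeOf u v) Ds') where

    on-chain : ∀ {u v} → SEdge (S ∪P P) u v → ∃ λ D → D ∈ Ds' × EdgeOf u v D
    on-chain e = find (Equivalence.to (chains' _ _) e)

    chain-edge : ∀ {D u v} → D ∈ Ds' → EdgeOf u v D → SEdge (S ∪P P) u v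
    chain-edge i e = Equivalence.from (chains' _ _) (lose i e)

    inner-of : ∀ {a z b} → Consec a z P → Consec z b P → Inner z P
    inner-of az zb = start , end , interior , P-shape ,
      entered-and-left⇒inner interior (subst Unique P-shape P-unique)
        (subst (Consec _ _) P-shape az) (subst (Consec _ _) P-shape zb)

    -- the root lies in S, so it is no inner vertex of P
    inner-not-root : ∀ {z} → Inner z P → z ≢ r
    inner-not-root inner refl = inner∉S _ inner (sequence-contains-root sq)

    inner-neighbour : ∀ {a z b w} → Consec a z P → Consec z b P →
                      SEdge (S ∪P P) z w → w ≡ a ⊎ w ≡ b
    inner-neighbour az zb e with split-edge e
    ... | inj₁ s = ⊥-elim (inner∉S _ (inner-of az zb) (_ , s))
    ... | inj₂ e = neighbour-of P-unique az zb e

    -- The chain Dz through the tree edge of an inner vertex z of P enters z and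
    -- leaves it towards p z, so it uses both edges of P at z; by
    -- edge-disjointness it is the chain D through the first of them.
    through-tree-edge : ∀ {D Dz a z b} → D ∈ Cs → Dz ∈ Ds' →
                        Consec a z P → Consec z b P → EdgeOf a z D → Consec z (p z) Dz →
                        EdgeOf z b D
    through-tree-edge {Dz = Dz} {a} {z} {b} D∈Cs Dz∈ az zb az∈D zpz with tree-step-entered (Ds'⊆Cs Dz∈) zpz
    ... | inj₂ zpz∈C₀ =
      ⊥-elim (inner∉S _ (inner-of az zb) (p z , inj₁ (sequence-contains-C₀ sq zpz∈C₀)))
    ... | inj₁ (q , qz) =
      subst (EdgeOf z _) (chains-edge-disjoint (Ds'⊆Cs Dz∈) D∈Cs (edge-sym (proj₁ a∧b)) az∈D)
            (proj₂ a∧b)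
      where
      a∧b : EdgeOf z a Dz × EdgeOf z b Dz
      a∧b = both-neighbours (inj₁ zpz) (inj₂ qz)
              (inner-neighbour az zb (chain-edge Dz∈ (inj₁ zpz)))
              (inner-neighbour az zb (chain-edge Dz∈ (inj₂ qz)))
              (λ pz≡q → predecessor-not-parent (Ds'⊆Cs Dz∈) (inner-not-root (inner-of az zb))
                                               qz (sym pz≡q))

    follows : ∀ {D a z b} → D ∈ Cs → Consec a z P → Consec z b P → EdgeOf a z D → EdgeOf z b D
    follows D∈Cs az zb az∈D
      with on-chain (uc' _ (_ , lift-P (inj₁ zb)) (inner-not-root (inner-of az zb)))
    ... | _ , Dz∈ , e = through-tree-edge D∈Cs Dz∈ az zb az∈D
                          (tree-edge-upwards (Ds'⊆Cs Dz∈) (inner-not-root (inner-of az zb)) e)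

    first-pair : ∃₂ λ x₁ rest → P ≡ start ∷ x₁ ∷ rest
    first-pair with nonempty-snoc interior end
    ... | x₁ , rest , eq = x₁ , rest , trans P-shape (cong (start ∷_) eq)

    x₁ : Fin n
    x₁ = proj₁ first-pair

    start-step : Consec start x₁ P
    start-step = subst (Consec start x₁) (sym (proj₂ (proj₂ first-pair))) here

    module ThroughFirstEdge {D : List (Fin n)} (D∈ : D ∈ Ds') (first∈D : EdgeOf start x₁ D) where

      D∈Cs : D ∈ Cs
      D∈Cs = Ds'⊆Cs D∈

      P⊑D : P ⊑ D
      P⊑D = propagate (λ u v → EdgeOf u v D) first-edge (follows D∈Cs)
        where
        first-edge : ∀ {u v t} → P ≡ u ∷ v ∷ t → EdgeOf u v D
        first-edge eq with trans (sym eq) (proj₂ (proj₂ first-pair))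
        ... | refl = first∈D

      -- D is no chain of S, since the first edge of P is not in S
      D-avoids-S : ∀ {u v} → EdgeOf u v D → ¬ SEdge S u v
      D-avoids-S e s with find (Equivalence.to (S-chains _ _) s)
      ... | E , E∈ , e' with chains-edge-disjoint D∈Cs (Ds⊆Cs E∈) e e'
      ...   | refl = edges∉S start x₁ start-step (Equivalence.from (S-chains _ _) (lose E∈ first∈D))

      D⊑P : D ⊑ P
      D⊑P c with split-edge (chain-edge D∈ (inj₁ c))
      ... | inj₁ s = ⊥-elim (D-avoids-S (inj₁ c) s)
      ... | inj₂ e = e

      P≈D : P ≡ D ⊎ P ≡ reverse D
      P≈D = same-edges⇒equal-up-to-reversal P-unique (chain-no-backtrack D∈Cs) D⊑P P⊑D first∈D

    is-chain : IsChain T Cs P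
    is-chain with on-chain (lift-P (inj₁ start-step))
    ... | D , D∈ , first∈D = lose (Ds'⊆Cs D∈) (ThroughFirstEdge.P≈D D∈ first∈D)

mainTheorem9 : ∀ {n : ℕ} (G : Graph n) → ThreeConnected G →
    (T : DFSTree G) → (Cs : List (List (Fin n))) → IsChainDecomposition T Cs →
    (S : Sub n) → InSequence T Cs S → UpwardsClosed T S → Modular T Cs S →
    (P : List (Fin n)) → IsBGPath G S P →
    (IsChain T Cs P ⇔ (UpwardsClosed T (S ∪P P) × Modular T Cs (S ∪P P)))
mainTheorem9 G _ T Cs dec S sq uc mod P bg = mk⇔ chain⇒closed-modular closed-modular⇒chain
  where
  open Extension T dec sq uc mod (bg-attachment {G = G} bg)

  chain⇒closed-modular : IsChain T Cs P → UpwardsClosed T (S ∪P P) × Modular T Cs (S ∪P P)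
  chain⇒closed-modular isChain with find isChain
  ... | C , C∈Cs , P≈C = ChainExtension.upwards-closed C∈Cs P≈C , ChainExtension.modular C∈Cs P≈C

  closed-modular⇒chain : UpwardsClosed T (S ∪P P) × Modular T Cs (S ∪P P) → IsChain T Cs P
  closed-modular⇒chain (uc' , Ds' , Ds'⊆Cs , chains') =
    ModularExtension.is-chain uc' Ds' Ds'⊆Cs chains'
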